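{- Let $G$ be a tree-path intersection graph with the rooting and order $\le$ described in the context. If $s_1\le s_2$, then $\min\Gamma(s_1)\le\min\Gamma(s_2)$.
   Context: A tree-path intersection graph is a connected bipartite graph $G$ with disjoint parts $G_H$, $G_V$, together with a tree $T_H$ on vertex set $G_H$ and a tree $T_V$ on vertex set $G_V$, such that for every $h\in G_H$ the neighbourhood $\Gamma(h)$ of $h$ in $G$ is the vertex set of a path in $T_V$, and for every $v\in G_V$ the neighbourhood $\Gamma(v)$ is the vertex set of a path in $T_H$. Fix an edge $h_{\mathrm{root}}v_{\mathrm{root}}\in E(G)$ such that $v_{\mathrm{root}}$ is a leaf of $T_V$; root $T_H$ at $h_{\mathrm{root}}$ and $T_V$ at $v_{\mathrm{root}}$. For $s_1,s_2$ both in $G_H$ (resp. both in $G_V$), $s_1\le s_2$ iff $s_1$ lies on the path of $T_H$ (resp. $T_V$) from the root to $s_2$; vertices from different sides are incomparable. $\min\Gamma(s)$ denotes the unique $\le$-minimal element of $\Gamma(s)$ (it exists since $\Gamma(s)$ is a path in a rooted tree). -}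

module Defs where

open import Level using (0ℓ)
open import Data.Nat using (ℕ; _≤_)
open import Data.Fin using (Fin)
open import Data.Sum using (_⊎_; inj₁; inj₂)
open import Data.Product using (Σ; ∃; ∃-syntax; _×_)
open import Data.Empty using (⊥)
open import Data.Maybe using (just)
open import Data.List using (List; head; last; length)
open import Data.List.Membership.Propositional using (_∈_)
open import Data.List.Relation.Unary.Linked using (Linked)
open import Data.List.Relation.Unary.Unique.Propositional using (Unique)
open import Relation.Nullary using (¬_)
open import Relation.Binary.PropositionalEquality using (_≡_)

record SimpleGraph (V : Set) : Set₁ where
  field
    Adj    : V → V → Set
    sym    : ∀ {x y} → Adj x y → Adj y x
    irrefl : ∀ {x} → ¬ Adj x x
open SimpleGraph public

module _ {V : Set} (A : V → V → Set) where

  IsPath : List V → Set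
  IsPath p = Unique p × Linked A p × (1 ≤ length p)

  PathFromTo : V → V → List V → Set
  PathFromTo u v p = IsPath p × head p ≡ just u × last p ≡ just v

  Connected : Set
  Connected = ∀ u v → ∃[ p ] PathFromTo u v p

  IsCycle : List V → Set
  IsCycle p = IsPath p × (3 ≤ length p) ×
              ∃[ x ] ∃[ y ] (head p ≡ just x × last p ≡ just y × A y x)

  IsPathVertexSet : (V → Set) → Set
  IsPathVertexSet S = ∃[ p ] (IsPath p × (∀ v → (S v → v ∈ p) × (v ∈ p → S v)))

  IsLeaf : V → Set
  IsLeaf r = ∀ x y → A r x → A r y → x ≡ y

  TreeLeq : V → V → V → Set
  TreeLeq r x y = ∃[ p ] (PathFromTo r y p × x ∈ p)

IsTree : {V : Set} → SimpleGraph V → Set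
IsTree T = Connected (Adj T) × (∀ p → ¬ IsCycle (Adj T) p)

BipAdj : {H V : Set} → (H → V → Set) → (H ⊎ V) → (H ⊎ V) → Set
BipAdj E (inj₁ h) (inj₁ h') = ⊥
BipAdj E (inj₁ h) (inj₂ v)  = E h v
BipAdj E (inj₂ v) (inj₁ h)  = E h v
BipAdj E (inj₂ v) (inj₂ v') = ⊥

Γ : {H V : Set} → (H → V → Set) → (H ⊎ V) → (H ⊎ V) → Set
Γ E s t = BipAdj E s t

record RootedTPIG : Set₁ where
  field
    nH nV : ℕ
    TH    : SimpleGraph (Fin nH)
    TV    : SimpleGraph (Fin nV)
    E     : Fin nH → Fin nV → Set
    TH-tree : IsTree TH
    TV-tree : IsTree TV
    G-connected : Connected (BipAdj E)
    Γh-path : ∀ h → IsPathVertexSet (Adj TV) (λ v → E h v)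
    Γv-path : ∀ v → IsPathVertexSet (Adj TH) (λ h → E h v)
    hroot : Fin nH
    vroot : Fin nV
    root-edge : E hroot vroot
    vroot-leaf : IsLeaf (Adj TV) vroot

  _≼_ : (Fin nH ⊎ Fin nV) → (Fin nH ⊎ Fin nV) → Set
  inj₁ a ≼ inj₁ b = TreeLeq (Adj TH) hroot a b
  inj₁ a ≼ inj₂ b = ⊥
  inj₂ a ≼ inj₁ b = ⊥
  inj₂ a ≼ inj₂ b = TreeLeq (Adj TV) vroot a b

  IsMinΓ : (Fin nH ⊎ Fin nV) → (Fin nH ⊎ Fin nV) → Set
  IsMinΓ s m = Γ E s m × (∀ t → Γ E s t → t ≼ m → t ≡ m)

module Submission where

-- Let a ≤ a′ in T_H and let R be the T_V-path from the root to some m′ ∈ Γ(a′). Every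
-- edge of T_V lies inside some Γ(x) (follow a path of G between its ends), so the x whose
-- Γ(x) meets R form a connected subtree of T_H; it contains the root and a′, hence the
-- whole root path to a′ and in particular a. The first vertex of R in Γ(a) lies below
-- every vertex of Γ(a), because the root path to it continues inside Γ(a); so it is the
-- minimum of Γ(a), which therefore lies on R below m′. The case of G_V is symmetric.

open import Defs
open import Data.Fin using (Fin)
import Data.Fin.Properties as Fin
open import Data.Sum using (_⊎_; inj₁; inj₂)
open import Data.Sum.Properties using (inj₁-injective; inj₂-injective)
open import Data.Nat using (_≤_; z≤n; s≤s)
open import Data.Product using (∃; ∃-syntax; _×_; _,_; proj₁; proj₂; uncurry)
open import Data.Empty using (⊥-elim)
open import Data.Maybe using (just)
open import Data.List using (List; []; _∷_; _++_; _∷ʳ_; [_]; reverse; head; last; length)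
open import Data.List.Properties using (unfold-reverse; reverse-++; length-reverse)
open import Data.List.Relation.Unary.Any using (Any; here; there)
open import Data.List.Relation.Unary.Any.Properties using (reverse⁻)
open import Data.List.Relation.Unary.All as All using (All; []; _∷_)
open import Data.List.Relation.Unary.All.Properties using (¬Any⇒All¬; ++⁻ˡ; ++⁻ʳ)
open import Data.List.Membership.Propositional using (_∈_; _∉_; lose)
open import Data.List.Membership.Propositional.Properties using (∈-++⁺ˡ; ∈-++⁺ʳ; ∈-++⁻)
import Data.List.Membership.DecPropositional as DecMembership
open import Data.List.Relation.Unary.Linked using (Linked; [-]; _∷_)
open import Data.List.Relation.Unary.Unique.Propositional using (Unique; []; _∷_)
open import Data.List.Relation.Unary.Unique.Propositional.Properties using (++⁺; Unique[x∷xs]⇒x∉xs)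
import Data.List.Relation.Binary.Permutation.Setoid as Permutation
import Data.List.Relation.Binary.Permutation.Setoid.Properties as PermutationProperties
open import Function using (_∘_; flip)
open import Relation.Nullary using (¬_; yes; no)
open import Relation.Unary using (Decidable)
open import Relation.Binary using (DecidableEquality; Symmetric)
open import Relation.Binary.PropositionalEquality
  using (_≡_; _≢_; refl; cong; subst; setoid)
  renaming (sym to ≡-sym)

module _ {V : Set} where

  Unique-∷ : ∀ {x : V} {xs} → x ∉ xs → Unique xs → Unique (x ∷ xs)
  Unique-∷ x∉xs xs! = ¬Any⇒All¬ _ x∉xs ∷ xs!

  Unique-tail : ∀ {x : V} {xs} → Unique (x ∷ xs) → Unique xs
  Unique-tail (_ ∷ xs!) = xs!

  Unique-++⁻ : ∀ (xs : List V) {ys} → Unique (xs ++ ys) → Unique xs × Unique ys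
  Unique-++⁻ []       ys!             = [] , ys!
  Unique-++⁻ (x ∷ xs) (x∉xsys ∷ xsys!) with xs! , ys! ← Unique-++⁻ xs xsys! =
    ++⁻ˡ xs x∉xsys ∷ xs! , ys!

  Unique-reverse : ∀ {xs : List V} → Unique xs → Unique (reverse xs)
  Unique-reverse {xs} = Unique-resp-↭ (↭-sym (↭-reverse xs))
    where open Permutation (setoid V); open PermutationProperties (setoid V)

data Walk {V : Set} (A : V → V → Set) : V → V → List V → Set where
  [-] : ∀ {u} → Walk A u u [ u ]
  _∷_ : ∀ {u w v xs} → A u w → Walk A w v xs → Walk A u v (u ∷ xs)

module _ {V : Set} {A : V → V → Set} where

  Walk-head∈ : ∀ {u v xs} → Walk A u v xs → u ∈ xs
  Walk-head∈ [-]     = here refl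
  Walk-head∈ (_ ∷ _) = here refl

  Walk-last∈ : ∀ {u v xs} → Walk A u v xs → v ∈ xs
  Walk-last∈ [-]     = here refl
  Walk-last∈ (_ ∷ W) = there (Walk-last∈ W)

  Walk-∷ʳ : ∀ {u v w xs} → Walk A u v xs → A v w → Walk A u w (xs ∷ʳ w)
  Walk-∷ʳ [-]     a = a ∷ [-]
  Walk-∷ʳ (b ∷ W) a = b ∷ Walk-∷ʳ W a

  Walk-++ : ∀ {u v w} xs {ys} → Walk A u v (xs ∷ʳ v) → Walk A v w ys → Walk A u w (xs ++ ys)
  Walk-++ []           [-]     W′ = W′
  Walk-++ []           (_ ∷ ()) _
  Walk-++ (_ ∷ [])     (a ∷ W) W′ = a ∷ Walk-++ [] W W′
  Walk-++ (_ ∷ x ∷ xs) (a ∷ W) W′ = a ∷ Walk-++ (x ∷ xs) W W′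

  Walk-reverse : Symmetric A → ∀ {u v xs} → Walk A u v xs → Walk A v u (reverse xs)
  Walk-reverse sym-A [-]                       = [-]
  Walk-reverse sym-A {u} {xs = _ ∷ xs} (a ∷ W) =
    subst (Walk A _ u) (≡-sym (unfold-reverse u xs)) (Walk-∷ʳ (Walk-reverse sym-A W) (sym-A a))

  Walk-suffix : ∀ {u w v xs} → u ∈ xs → Walk A w v xs →
                ∃[ pre ] ∃[ ys ] (xs ≡ pre ++ ys × Walk A u v ys)
  Walk-suffix (here refl) [-]     = [] , _ , refl , [-]
  Walk-suffix (here refl) (a ∷ W) = [] , _ , refl , a ∷ W
  Walk-suffix (there u∈) (_ ∷ W) with pre , ys , refl , W′ ← Walk-suffix u∈ W =
    _ ∷ pre , ys , refl , W′

  Walk-splitAtFirst : ∀ {Q : V → Set} → Decidable Q → ∀ {u v xs} → Walk A u v xs → Any Q xs →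
    ∃[ pre ] ∃[ c ] ∃[ post ]
      (xs ≡ pre ++ c ∷ post × Q c × All (¬_ ∘ Q) pre × Walk A u c (pre ∷ʳ c))
  Walk-splitAtFirst Q? {u} [-] (here q) = [] , u , [] , refl , q , [] , [-]
  Walk-splitAtFirst Q? {u} (a ∷ W) qs with Q? u | qs
  ... | yes q | _         = [] , u , _ , refl , q , [] , [-]
  ... | no ¬q | here q    = ⊥-elim (¬q q)
  ... | no ¬q | there qs′
    with pre , c , post , refl , q , ¬qs , Wc ← Walk-splitAtFirst Q? W qs′ =
    u ∷ pre , c , post , refl , q , ¬q ∷ ¬qs , a ∷ Wc

  Linked⇒Walk : ∀ {u v xs} → Linked A xs → head xs ≡ just u → last xs ≡ just v → Walk A u v xs
  Linked⇒Walk {xs = _ ∷ []}    [-]      refl refl = [-]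
  Linked⇒Walk {xs = _ ∷ _ ∷ _} (a ∷ xs) refl l    = a ∷ Linked⇒Walk xs refl l

  Walk⇒Linked : ∀ {u v xs} → Walk A u v xs → Linked A xs × head xs ≡ just u × last xs ≡ just v
  Walk⇒Linked [-]           = [-] , refl , refl
  Walk⇒Linked (a ∷ [-])     = a ∷ [-] , refl , refl
  Walk⇒Linked (a ∷ (b ∷ W)) with L , _ , l ← Walk⇒Linked (b ∷ W) = a ∷ L , refl , l

  Walk⇒PathFromTo : ∀ {u v xs} → Walk A u v xs → Unique xs → PathFromTo A u v xs
  Walk⇒PathFromTo W xs! with L , h , l ← Walk⇒Linked W = (xs! , L , nonempty W) , h , l
    where
    nonempty : ∀ {u v xs} → Walk A u v xs → 1 ≤ length xs
    nonempty [-]     = s≤s z≤n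
    nonempty (_ ∷ _) = s≤s z≤n

  PathFromTo⇒Walk : ∀ {u v xs} → PathFromTo A u v xs → Walk A u v xs × Unique xs
  PathFromTo⇒Walk ((xs! , L , _) , h , l) = Linked⇒Walk L h l , xs!

data ReachIn {V : Set} (A : V → V → Set) (P : V → Set) : V → V → Set where
  stay : ∀ {u} → P u → ReachIn A P u u
  move : ∀ {u w v} → P u → A u w → ReachIn A P w v → ReachIn A P u v

module _ {V : Set} {A : V → V → Set} {P : V → Set} where

  ReachIn-start : ∀ {u v} → ReachIn A P u v → P u
  ReachIn-start (stay p)     = p
  ReachIn-start (move p _ _) = p

  ReachIn-trans : ∀ {u v w} → ReachIn A P u v → ReachIn A P v w → ReachIn A P u w
  ReachIn-trans (stay _)     r′ = r′
  ReachIn-trans (move p a r) r′ = move p a (ReachIn-trans r r′)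

  ReachIn-sym : Symmetric A → ∀ {u v} → ReachIn A P u v → ReachIn A P v u
  ReachIn-sym sym-A (stay p)     = stay p
  ReachIn-sym sym-A (move p a r) =
    ReachIn-trans (ReachIn-sym sym-A r) (move (ReachIn-start r) (sym-A a) (stay p))

  Linked⇒ReachIn : Symmetric A → ∀ {xs x y} → All P xs → Linked A xs → x ∈ xs → y ∈ xs →
                   ReachIn A P x y
  Linked⇒ReachIn sym-A {x₀ ∷ _} Ps L x∈ y∈ =
    ReachIn-trans (ReachIn-sym sym-A (from-head Ps L x∈)) (from-head Ps L y∈)
    where
    from-head : ∀ {x xs y} → All P (x ∷ xs) → Linked A (x ∷ xs) → y ∈ x ∷ xs → ReachIn A P x y
    from-head (p ∷ _)  _       (here refl) = stay p
    from-head (p ∷ Ps) (a ∷ L) (there y∈)  = move p a (from-head Ps L y∈)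

  ReachIn⇒Path : DecidableEquality V → ∀ {u v} → ReachIn A P u v →
                 ∃[ xs ] (Walk A u v xs × Unique xs × All P xs)
  ReachIn⇒Path _≟_ (stay p) = _ , [-] , [] ∷ [] , p ∷ []
  ReachIn⇒Path _≟_ {u} (move p a r) with xs , W , xs! , Ps ← ReachIn⇒Path _≟_ r | u ∈? xs
    where open DecMembership _≟_ using (_∈?_)
  ... | no u∉xs = u ∷ xs , a ∷ W , Unique-∷ u∉xs xs! , p ∷ Ps
  ... | yes u∈xs with pre , ys , refl , W′ ← Walk-suffix u∈xs W =
    ys , W′ , proj₂ (Unique-++⁻ pre xs!) , ++⁻ʳ pre Ps

  ReachIn⇒TreeLeq : DecidableEquality V → ∀ {r c m} pre → Walk A r c (pre ∷ʳ c) → Unique pre →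
                    All (¬_ ∘ P) pre → ReachIn A P c m → TreeLeq A r c m
  ReachIn⇒TreeLeq _≟_ pre W pre! pre∉P r with xs , W′ , xs! , xs⊆P ← ReachIn⇒Path _≟_ r =
    pre ++ xs , Walk⇒PathFromTo (Walk-++ pre W W′) (++⁺ pre! xs! pre#xs) ,
    ∈-++⁺ʳ pre (Walk-head∈ W′)
    where
    pre#xs : ∀ {t} → ¬ (t ∈ pre × t ∈ xs)
    pre#xs (t∈pre , t∈xs) = All.lookup pre∉P t∈pre (All.lookup xs⊆P t∈xs)

ReachIn-map : ∀ {V} {A : V → V → Set} {P Q : V → Set} → (∀ {t} → P t → Q t) →
              ∀ {u v} → ReachIn A P u v → ReachIn A Q u v
ReachIn-map f (stay p)     = stay (f p)
ReachIn-map f (move p a r) = move (f p) a (ReachIn-map f r)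

module _ {V : Set} {A : V → V → Set} {S : V → Set} where

  PathVertexSet⇒ReachIn : Symmetric A → IsPathVertexSet A S → ∀ {u v} → S u → S v → ReachIn A S u v
  PathVertexSet⇒ReachIn sym-A (xs , (_ , L , _) , S⇔∈) Su Sv =
    Linked⇒ReachIn sym-A (All.tabulate (proj₂ (S⇔∈ _))) L (proj₁ (S⇔∈ _) Su) (proj₁ (S⇔∈ _) Sv)

  PathVertexSet-dec : DecidableEquality V → IsPathVertexSet A S → Decidable S
  PathVertexSet-dec _≟_ (xs , _ , S⇔∈) v with v ∈? xs
    where open DecMembership _≟_ using (_∈?_)
  ... | yes v∈ = yes (proj₂ (S⇔∈ v) v∈)
  ... | no  v∉ = no (v∉ ∘ proj₁ (S⇔∈ v))

module Forest {V : Set} (_≟_ : DecidableEquality V) (A : V → V → Set)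
              (sym-A : Symmetric A) (acyclic : ∀ p → ¬ IsCycle A p) where

  open DecMembership _≟_ using (_∈?_)

  private
    cycle-length : ∀ {u w w₁ w₂} cs as → Walk A w₁ w (cs ∷ʳ w) → Walk A w₂ w (as ∷ʳ w) →
                   w₁ ≢ w₂ → 3 ≤ length (u ∷ cs ++ w ∷ reverse as)
    cycle-length (c ∷ cs) as _ _ _ = s≤s (s≤s (middle cs))
      where
      middle : ∀ xs {y ys} → 1 ≤ length (xs ++ y ∷ ys)
      middle []      = s≤s z≤n
      middle (_ ∷ _) = s≤s z≤n
    cycle-length [] (a ∷ as) _ _ _ =
      s≤s (s≤s (subst (1 ≤_) (≡-sym (length-reverse (a ∷ as))) (s≤s z≤n)))
    cycle-length [] [] [-]       [-]       w₁≢w₂ = ⊥-elim (w₁≢w₂ refl)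
    cycle-length [] [] (_ ∷ ())  _         _
    cycle-length [] [] [-]       (_ ∷ ())  _

    -- Follow the second path until it first meets the first one at w; the first path
    -- up to w and the second one back from w close a cycle through u.
    cycle : ∀ {u w₁ w₂ v P Q} → A u w₁ → Walk A w₁ v P → Unique (u ∷ P) →
            A u w₂ → Walk A w₂ v Q → Unique (u ∷ Q) → w₁ ≢ w₂ → ∃ (IsCycle A)
    cycle {u} {w₁} {w₂} {P = P} a₁ W₁ uP! a₂ W₂ uQ! w₁≢w₂
      with as , w , _ , refl , w∈P , as∉P , WQ
             ← Walk-splitAtFirst (_∈? P) W₂ (lose (Walk-last∈ W₂) (Walk-last∈ W₁))
      with cs , .w , _ , refl , refl , cs≢w , WP
             ← Walk-splitAtFirst (_≟ w) W₁ (lose w∈P refl)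
      = C , proj₁ path-C , cycle-length {u = u} cs as WP WQ w₁≢w₂ ,
        u , w₂ , proj₁ (proj₂ path-C) , proj₂ (proj₂ path-C) , sym-A a₂
      where
      C : List V
      C = u ∷ cs ++ w ∷ reverse as
      back : Walk A w w₂ (w ∷ reverse as)
      back = subst (Walk A w w₂) (reverse-++ as [ w ]) (Walk-reverse sym-A WQ)
      cs! = proj₁ (Unique-++⁻ cs (Unique-tail uP!))
      as! = proj₁ (Unique-++⁻ as (Unique-tail uQ!))
      w∷as! : Unique (w ∷ reverse as)
      w∷as! = Unique-∷ (λ w∈ → All.lookup as∉P (reverse⁻ w∈) w∈P) (Unique-reverse as!)
      cs#w∷as : ∀ {t} → ¬ (t ∈ cs × t ∈ w ∷ reverse as)
      cs#w∷as (t∈cs , here refl) = All.lookup cs≢w t∈cs refl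
      cs#w∷as (t∈cs , there t∈) = All.lookup as∉P (reverse⁻ t∈) (∈-++⁺ˡ t∈cs)
      u∉C : u ∉ cs ++ w ∷ reverse as
      u∉C u∈ with ∈-++⁻ cs u∈
      ... | inj₁ u∈cs          = Unique[x∷xs]⇒x∉xs uP! (∈-++⁺ˡ u∈cs)
      ... | inj₂ (here refl)   = Unique[x∷xs]⇒x∉xs uP! w∈P
      ... | inj₂ (there u∈as) = Unique[x∷xs]⇒x∉xs uQ! (∈-++⁺ˡ (reverse⁻ {xs = as} u∈as))
      C! : Unique C
      C! = Unique-∷ u∉C (++⁺ cs! w∷as! cs#w∷as)
      path-C : PathFromTo A u w₂ C
      path-C = Walk⇒PathFromTo (a₁ ∷ Walk-++ cs WP back) C!

  path-unique : ∀ {u v p q} → Walk A u v p → Unique p → Walk A u v q → Unique q → p ≡ q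
  path-unique [-]     _  [-]     _  = refl
  path-unique [-]     _  (_ ∷ W) q! = ⊥-elim (Unique[x∷xs]⇒x∉xs q! (Walk-last∈ W))
  path-unique (_ ∷ W) p! [-]     _  = ⊥-elim (Unique[x∷xs]⇒x∉xs p! (Walk-last∈ W))
  path-unique (_∷_ {w = w₁} a₁ W₁) p! (_∷_ {w = w₂} a₂ W₂) q! with w₁ ≟ w₂
  ... | yes refl  = cong (_ ∷_) (path-unique W₁ (Unique-tail p!) W₂ (Unique-tail q!))
  ... | no w₁≢w₂ = ⊥-elim (uncurry acyclic (cycle a₁ W₁ p! a₂ W₂ q! w₁≢w₂))

  ReachIn-convex : ∀ {P u v p} → ReachIn A P u v → Walk A u v p → Unique p → All P p
  ReachIn-convex r W p! with xs , W′ , xs! , Ps ← ReachIn⇒Path _≟_ r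
    rewrite path-unique W p! W′ xs! = Ps

  ReachIn-neighbour : ∀ {P u v w} → ReachIn A P u v → ReachIn A (_≢ v) u w → A w v → P w
  ReachIn-neighbour r r′ a with xs , W , xs! , xs≢v ← ReachIn⇒Path _≟_ r′ =
    All.lookup (ReachIn-convex r (Walk-∷ʳ W a) (++⁺ xs! ([] ∷ []) xs#v)) (∈-++⁺ˡ (Walk-last∈ W))
    where
    xs#v : ∀ {t} → ¬ (t ∈ xs × t ∈ [ _ ])
    xs#v (t∈ , here refl) = All.lookup xs≢v t∈ refl

data Zigzag {X Y : Set} (E : X → Y → Set) : Y → Y → Set where
  []  : ∀ {y} → Zigzag E y y
  hop : ∀ {x y y′ y″} → E x y → E x y′ → Zigzag E y′ y″ → Zigzag E y y″

module OneSide {X Y : Set} (_≟X_ : DecidableEquality X) (_≟Y_ : DecidableEquality Y)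
  (TX : SimpleGraph X) (TY : SimpleGraph Y) (TX-tree : IsTree TX) (TY-tree : IsTree TY)
  (E : X → Y → Set)
  (Γx-path : ∀ x → IsPathVertexSet (Adj TY) (λ y → E x y))
  (Γy-path : ∀ y → IsPathVertexSet (Adj TX) (λ x → E x y))
  (zigzag : ∀ y y′ → Zigzag E y y′)
  {x₀ y₀} (root-edge : E x₀ y₀) where

  module FX = Forest _≟X_ (Adj TX) (sym TX) (proj₂ TX-tree)
  module FY = Forest _≟Y_ (Adj TY) (sym TY) (proj₂ TY-tree)

  Γx-reach : ∀ {x y y′} → E x y → E x y′ → ReachIn (Adj TY) (E x) y y′
  Γx-reach {x} = PathVertexSet⇒ReachIn (sym TY) (Γx-path x)

  Γy-reach : ∀ {x x′ y} → E x y → E x′ y → ReachIn (Adj TX) (λ t → E t y) x x′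
  Γy-reach {y = y} = PathVertexSet⇒ReachIn (sym TX) (Γy-path y)

  E? : ∀ x → Decidable (E x)
  E? x = PathVertexSet-dec _≟Y_ (Γx-path x)

  -- Follow a zigzag from y to y′, keeping a walk back to y that avoids y′; the first x
  -- with y′ ∈ Γ(x) also has y ∈ Γ(x).
  edge-covered : ∀ {y y′} → Adj TY y y′ → ∃[ x ] (E x y × E x y′)
  edge-covered {y} {y′} a = go (zigzag y y′) (stay y≢y′)
    where
    y≢y′ : y ≢ y′
    y≢y′ refl = irrefl TY a
    go : ∀ {z} → Zigzag E z y′ → ReachIn (Adj TY) (_≢ y′) z y → ∃[ x ] (E x y × E x y′)
    go []                r = ⊥-elim (ReachIn-start r refl)
    go (hop {x} e e′ zz) r with E? x y′
    ... | yes ey′ = x , FY.ReachIn-neighbour (Γx-reach e ey′) r a , ey′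
    ... | no ¬ey′ = go zz (ReachIn-trans (ReachIn-map avoid (Γx-reach e′ e)) r)
      where
      avoid : ∀ {t} → E x t → t ≢ y′
      avoid et refl = ¬ey′ et

  Meets : List Y → X → Set
  Meets ys x = Any (E x) ys

  Meets-connected : ∀ {b c ys x x′} → Walk (Adj TY) b c ys → E x b → E x′ c →
                    ReachIn (Adj TX) (Meets ys) x x′
  Meets-connected [-] e e′ = ReachIn-map here (Γy-reach e e′)
  Meets-connected (a ∷ W) e e′ with x₁ , e₁ , e₁′ ← edge-covered a =
    ReachIn-trans (ReachIn-map here (Γy-reach e e₁)) (ReachIn-map there (Meets-connected W e₁′ e′))

  MinΓ : X → Y → Set
  MinΓ x m = E x m × (∀ t → E x t → TreeLeq (Adj TY) y₀ t m → t ≡ m)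

  MinΓ-on-root-path : ∀ {x m v ys} → MinΓ x m → Walk (Adj TY) y₀ v ys → Unique ys →
                      Any (E x) ys → m ∈ ys
  MinΓ-on-root-path {x} (em , minimal) W ys! meets
    with pre , c , _ , refl , ec , pre∉Γ , Wc ← Walk-splitAtFirst (E? x) W meets
    with refl ← minimal c ec
                  (ReachIn⇒TreeLeq _≟Y_ pre Wc (proj₁ (Unique-++⁻ pre ys!)) pre∉Γ (Γx-reach ec em))
    = ∈-++⁺ʳ pre (here refl)

  MinΓ-monotone : ∀ {a a′ m m′} → TreeLeq (Adj TX) x₀ a a′ → MinΓ a m → E a′ m′ →
                  TreeLeq (Adj TY) y₀ m m′
  MinΓ-monotone {a} {m′ = m′} (ps , root⇝a′ , a∈ps) min-m em′
    with R , root⇝m′ ← proj₁ TY-tree y₀ m′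
    with WR , R! ← PathFromTo⇒Walk root⇝m′
    with Wps , ps! ← PathFromTo⇒Walk root⇝a′
    = R , root⇝m′ , MinΓ-on-root-path min-m WR R! a-meets-R
    where
    a-meets-R : Meets R a
    a-meets-R = All.lookup (FX.ReachIn-convex (Meets-connected WR root-edge em′) Wps ps!) a∈ps

zigzagᴿ : ∀ {H V : Set} {E : H → V → Set} {y y′ xs} →
          Walk (BipAdj E) (inj₂ y) (inj₂ y′) xs → Zigzag E y y′
zigzagᴿ [-]                                          = []
zigzagᴿ (_∷_ {w = inj₁ _} e (_∷_ {w = inj₂ _} e′ W)) = hop e e′ (zigzagᴿ W)
zigzagᴿ (_∷_ {w = inj₁ _} _ (_∷_ {w = inj₁ _} () _))
zigzagᴿ (_∷_ {w = inj₂ _} () _)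

zigzagᴸ : ∀ {H V : Set} {E : H → V → Set} {x x′ xs} →
          Walk (BipAdj E) (inj₁ x) (inj₁ x′) xs → Zigzag (flip E) x x′
zigzagᴸ [-]                                          = []
zigzagᴸ (_∷_ {w = inj₂ _} e (_∷_ {w = inj₁ _} e′ W)) = hop e e′ (zigzagᴸ W)
zigzagᴸ (_∷_ {w = inj₂ _} _ (_∷_ {w = inj₂ _} () _))
zigzagᴸ (_∷_ {w = inj₁ _} () _)

module Sides (G : RootedTPIG) where
  open RootedTPIG G

  G-walk : ∀ s t → ∃ (Walk (BipAdj E) s t)
  G-walk s t = _ , proj₁ (PathFromTo⇒Walk (proj₂ (G-connected s t)))

  module H = OneSide Fin._≟_ Fin._≟_ TH TV TH-tree TV-tree E Γh-path Γv-path
               (λ y y′ → zigzagᴿ (proj₂ (G-walk (inj₂ y) (inj₂ y′)))) root-edge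
  module V = OneSide Fin._≟_ Fin._≟_ TV TH TV-tree TH-tree (flip E) Γv-path Γh-path
               (λ x x′ → zigzagᴸ (proj₂ (G-walk (inj₁ x) (inj₁ x′)))) root-edge

lemma11 : (G : RootedTPIG) → let open RootedTPIG G in
          (s₁ s₂ m₁ m₂ : Fin nH ⊎ Fin nV) →
          s₁ ≼ s₂ → IsMinΓ s₁ m₁ → IsMinΓ s₂ m₂ → m₁ ≼ m₂
lemma11 G (inj₁ a) (inj₁ a′) (inj₂ m) (inj₂ m′) a≤a′ (e , minimal) (e′ , _) =
  Sides.H.MinΓ-monotone G a≤a′ (e , λ t et t≤m → inj₂-injective (minimal (inj₂ t) et t≤m)) e′
lemma11 G (inj₂ v) (inj₂ v′) (inj₁ m) (inj₁ m′) v≤v′ (e , minimal) (e′ , _) =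
  Sides.V.MinΓ-monotone G v≤v′ (e , λ t et t≤m → inj₁-injective (minimal (inj₁ t) et t≤m)) e′
lemma11 G (inj₁ _) (inj₂ _) _ _ () _ _
lemma11 G (inj₂ _) (inj₁ _) _ _ () _ _
lemma11 G (inj₁ _) (inj₁ _) (inj₁ _) _        _ (() , _) _
lemma11 G (inj₁ _) (inj₁ _) (inj₂ _) (inj₁ _) _ _        (() , _)
lemma11 G (inj₂ _) (inj₂ _) (inj₂ _) _        _ (() , _) _
lemma11 G (inj₂ _) (inj₂ _) (inj₁ _) (inj₂ _) _ _        (() , _)
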